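{- For all positive integers $k$ and $f$, the pair $(2k-1, \lfloor f/k \rfloor - 2)$ is not restorable relative to $f$; that is, there exist an undirected unweighted graph $G$ and an $f$-fault replacement path in $G$ that cannot be partitioned into $2k-1$ consecutive subpaths which are each $(\lfloor f/k \rfloor - 2)$-fault replacement paths in $G$.
   Context: All graphs are finite, undirected and unweighted. For an integer $r$, a path $\pi$ in a graph $G=(V,E)$ is an $r$-fault replacement path if there exists a set of edges $F \subseteq E$ with $|F| \le r$ such that $\pi$ is a shortest path between its endpoints in $G \setminus F$. Relative to a value of $f$, a pair $(q, r)$ is called restorable if in every graph $G$, every $f$-fault replacement path can be partitioned into $q$ consecutive subpaths (consecutive subpaths sharing their boundary vertex) which are each $r$-fault replacement paths in $G$. -}

module Defs where

open import Data.Nat using (ℕ; zero; suc; _+_; _∸_; _≤_; _<_)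
open import Data.Bool using (Bool; T)
open import Data.Fin using (Fin)
open import Data.List using (List; length)
open import Data.List.Relation.Unary.All using (All)
open import Data.List.Membership.Propositional using (_∈_)
open import Data.Product using (Σ; _×_; _,_; proj₁; proj₂)
open import Data.Integer as ℤ using (ℤ; +_)
open import Relation.Nullary using (¬_)
open import Relation.Binary.PropositionalEquality using (_≡_)

record Graph (n : ℕ) : Set where
  field
    adj   : Fin n → Fin n → Bool
    sym   : ∀ u v → adj u v ≡ adj v u
    irrefl : ∀ u → ¬ T (adj u u)
open Graph public

Edge : ∀ {n} → Graph n → Fin n → Fin n → Set
Edge G u v = T (adj G u v)

-- A fault set: a list of edges of G (each undirected edge {u,v} given as
-- an ordered pair (u , v)).  Its size is bounded via its length.
Faults : ℕ → Set
Faults n = List (Fin n × Fin n)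

EdgeMinus : ∀ {n} → Graph n → Faults n → Fin n → Fin n → Set
EdgeMinus G F u v = Edge G u v × ¬ ((u , v) ∈ F) × ¬ ((v , u) ∈ F)

-- A walk of length ℓ (ℓ edges) is given by its vertex sequence p 0, …, p ℓ
-- (values of p beyond ℓ are irrelevant).
IsWalk : ∀ {n} → (Fin n → Fin n → Set) → ℕ → (ℕ → Fin n) → Set
IsWalk R ℓ p = ∀ i → i < ℓ → R (p i) (p (suc i))

IsShortestPath : ∀ {n} → (Fin n → Fin n → Set) → ℕ → (ℕ → Fin n) → Set
IsShortestPath {n} R ℓ p =
  IsWalk R ℓ p ×
  (∀ m (q : ℕ → Fin n) → IsWalk R m q → q 0 ≡ p 0 → q m ≡ p ℓ → ℓ ≤ m)

-- π (length ℓ, vertices p) is an r-fault replacement path in G (r : ℤ, so that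
-- a negative r admits no fault set): there is a set F ⊆ E(G) with |F| ≤ r
-- such that π is a shortest path between its endpoints in G ∖ F.
IsReplacementPath : ∀ {n} → Graph n → ℤ → ℕ → (ℕ → Fin n) → Set
IsReplacementPath {n} G r ℓ p =
  Σ (Faults n) λ F →
    (+ length F ℤ.≤ r) ×
    All (λ e → Edge G (proj₁ e) (proj₂ e)) F ×
    IsShortestPath (EdgeMinus G F) ℓ p

subpathVertices : ∀ {n} → (ℕ → Fin n) → ℕ → (ℕ → Fin n)
subpathVertices p i k = p (i + k)

-- π can be partitioned into q consecutive subpaths (consecutive subpaths
-- share their boundary vertex; subpaths may be trivial) each of which is an
-- r-fault replacement path in G.
Partitionable : ∀ {n} → Graph n → ℕ → ℤ → ℕ → (ℕ → Fin n) → Set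
Partitionable G q r ℓ p =
  Σ (ℕ → ℕ) λ b →
    (b 0 ≡ 0) × (b q ≡ ℓ) ×
    (∀ i → i < q → b i ≤ b (suc i)) ×
    (∀ i → i < q →
       IsReplacementPath G r (b (suc i) ∸ b i) (subpathVertices p (b i)))

Restorable : ℕ → ℕ → ℤ → Set
Restorable f q r =
  ∀ (n : ℕ) (G : Graph n) (ℓ : ℕ) (p : ℕ → Fin n) →
    IsReplacementPath G (+ f) ℓ p → Partitionable G q r ℓ p

-- Lay a spine path 0, 1, …, N = kL out in k blocks of length L. From the start gL of block g,
-- m = ⌊f/k⌋ jumps lead to gL + a + 3c (c < m), and h = m − 1 copies of the spine ("layers") are
-- attached to it by a rung at every position. Faulting all km ≤ f jumps leaves the position a
-- potential that grows by at most one per edge, so the spine is an f-fault replacement path.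
-- A set of at most m − 2 faults, however, leaves in every block some jump c and some layer
-- untouched, giving a path of length 3c + 3 < a across [gL, gL + a] (jump, rung, back along
-- the layer, rung), and leaves two jumps lo < hi untouched, giving a path of length 2 from
-- gL + a + 3lo to gL + a + 3hi inside [gL + a − 1, (g + 1)L]. Every (m − 2)-fault piece of the
-- spine therefore ends before the end of the next of these 2k − 1 overlapping windows, so
-- 2k − 1 pieces cannot reach N. If ⌊f/k⌋ < 2 the budget m − 2 is negative and not even a
-- one-vertex path can be split.

module Submission where

open import Defs hiding (sym)
open import Data.Nat using (ℕ; zero; suc; _+_; _*_; _∸_; _/_; _⊔_; _≤_; _<_; s≤s; z≤n; _≟_; _<?_; NonZero)
open import Data.Nat.Properties
open import Data.Nat.DivMod using (m*n/n≡m; m/n*n≤m)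
open import Data.Nat.Tactic.RingSolver using (solve-∀)
open import Data.Integer as ℤ using (+_; _-_; -<+; +≤+)
import Data.Integer.Properties as ℤ
open import Data.Fin using (Fin; toℕ; fromℕ<; combine; remQuot)
open import Data.Fin.Properties using (toℕ-fromℕ<; toℕ-injective; toℕ≤pred[n]; remQuot-combine; combine-remQuot)
open import Data.Bool using (Bool; T; false; _∨_)
open import Data.Bool.Properties using (∨-comm; T-∨)
open import Data.List using (List; []; _∷_; _++_; length; map; filter; upTo; cartesianProductWith)
open import Data.List.Properties using (length-map; length-++; length-upTo; filter-notAll)
open import Data.List.Relation.Unary.All as All using ([])
open import Data.List.Relation.Unary.Any as Any using (here; there; any?)
open import Data.List.Membership.Propositional using (_∈_; _∉_)
open import Data.List.Membership.Propositional.Properties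
  using (∈-map⁺; ∈-map⁻; ∈-filter⁺; ∈-upTo⁺; ∈-upTo⁻; ∈-cartesianProductWith⁺; ∈-cartesianProductWith⁻)
open import Data.Product using (Σ; ∃-syntax; _×_; _,_; proj₁; proj₂)
open import Data.Product.Properties using (≡-dec)
open import Data.List.Membership.DecPropositional (≡-dec _≟_ _≟_) using (_∈?_)
open import Data.Sum as Sum using (_⊎_; inj₁; inj₂; [_,_])
open import Function using (_⇔_; mk⇔; Equivalence; _∘_; _∘′_)
open import Relation.Nullary using (¬_; ¬?; Dec; yes; no; contradiction)
open import Relation.Nullary.Decidable using (isYes; toWitness; fromWitness; _×-dec_; _⊎-dec_)
open import Relation.Binary.Definitions using (Decidable; tri<; tri≈; tri>)
open import Relation.Binary.PropositionalEquality
  using (_≡_; refl; sym; trans; cong; cong₂; subst; subst₂; module ≡-Reasoning)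

module _ {n : ℕ} (R : Fin n → Fin n → Set) where

  data Walk : ℕ → Fin n → Fin n → Set where
    []  : ∀ {u} → Walk 0 u u
    _∷_ : ∀ {u v w ℓ} → R u v → Walk ℓ v w → Walk (suc ℓ) u w

module _ {n : ℕ} {R : Fin n → Fin n → Set} where

  infixr 5 _++ʷ_
  _++ʷ_ : ∀ {a b u v w} → Walk R a u v → Walk R b v w → Walk R (a + b) u w
  [] ++ʷ q = q
  (e ∷ p) ++ʷ q = e ∷ (p ++ʷ q)

  walk⇒isWalk : ∀ {ℓ u v} → Walk R ℓ u v →
                Σ (ℕ → Fin n) λ q → IsWalk R ℓ q × q 0 ≡ u × q ℓ ≡ v
  walk⇒isWalk {u = u} [] = (λ _ → u) , (λ _ ()) , refl , refl
  walk⇒isWalk {u = u} (e ∷ p) with q , w , refl , refl ← walk⇒isWalk p = q′ , w′ , refl , refl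
    where
    q′ : ℕ → Fin n
    q′ zero = u
    q′ (suc i) = q i
    w′ : IsWalk R _ q′
    w′ zero _ = e
    w′ (suc i) (s≤s i<ℓ) = w i i<ℓ

  isWalk⇒walk : ∀ {ℓ p} → IsWalk R ℓ p → ∀ i d → i + d ≤ ℓ → Walk R d (p i) (p (i + d))
  isWalk⇒walk w i zero _ rewrite +-identityʳ i = []
  isWalk⇒walk {ℓ} {p} w i (suc d) i+d<ℓ =
    w i (≤-trans (s≤s (m≤m+n i d)) i+d<ℓ′) ∷
    subst (λ j → Walk R d (p (suc i)) (p j)) (sym (+-suc i d)) (isWalk⇒walk w (suc i) d i+d<ℓ′)
    where
    i+d<ℓ′ : suc i + d ≤ ℓ
    i+d<ℓ′ = subst (_≤ ℓ) (+-suc i d) i+d<ℓ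

  shortest-minimal : ∀ {ℓ p M} → IsShortestPath R ℓ p → Walk R M (p 0) (p ℓ) → ℓ ≤ M
  shortest-minimal (_ , minimal) q with q′ , w , q0 , qM ← walk⇒isWalk q = minimal _ q′ w q0 qM

  -- The detour is spliced between the prefix and suffix of p, and the result compared with p.
  shortest-segment : ∀ {ℓ p M i j} → IsShortestPath R ℓ p → i ≤ j → j ≤ ℓ →
                     Walk R M (p i) (p j) → j ≤ i + M
  shortest-segment {ℓ} {p} {M} {i} {j} sp@(w , _) i≤j j≤ℓ detour =
    +-cancelʳ-≤ rest j (i + M) (begin
      j + rest       ≡⟨ m+[n∸m]≡n j≤ℓ ⟩
      ℓ              ≤⟨ shortest-minimal sp (prefix ++ʷ detour ++ʷ suffix) ⟩
      i + (M + rest) ≡⟨ sym (+-assoc i M rest) ⟩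
      i + M + rest   ∎)
    where
    open ≤-Reasoning
    rest : ℕ
    rest = ℓ ∸ j
    prefix : Walk R i (p 0) (p i)
    prefix = isWalk⇒walk w 0 i (≤-trans i≤j j≤ℓ)
    suffix : Walk R rest (p j) (p ℓ)
    suffix = subst (λ t → Walk R rest (p j) (p t)) (m+[n∸m]≡n j≤ℓ)
               (isWalk⇒walk w j rest (≤-reflexive (m+[n∸m]≡n j≤ℓ)))

  shortest-between : ∀ {ℓ o s s′ M} {p : ℕ → Fin n} → IsShortestPath R ℓ (λ t → p (o + t)) →
                     o ≤ s → s ≤ s′ → s′ ≤ o + ℓ → Walk R M (p s) (p s′) → s′ ≤ s + M
  shortest-between {ℓ} {o} {s} {s′} {M} {p} sp o≤s s≤s′ s′≤o+ℓ detour = begin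
    s′                  ≡⟨ sym (m+[n∸m]≡n o≤s′) ⟩
    o + (s′ ∸ o)        ≤⟨ +-monoʳ-≤ o (shortest-segment {p = λ t → p (o + t)} sp (∸-monoˡ-≤ o s≤s′) s′∸o≤ℓ detour′) ⟩
    o + ((s ∸ o) + M)   ≡⟨ sym (+-assoc o (s ∸ o) M) ⟩
    o + (s ∸ o) + M     ≡⟨ cong (_+ M) (m+[n∸m]≡n o≤s) ⟩
    s + M               ∎
    where
    open ≤-Reasoning
    o≤s′ : o ≤ s′
    o≤s′ = ≤-trans o≤s s≤s′
    s′∸o≤ℓ : s′ ∸ o ≤ ℓ
    s′∸o≤ℓ = subst (s′ ∸ o ≤_) (m+n∸m≡n o ℓ) (∸-monoˡ-≤ o s′≤o+ℓ)
    detour′ : Walk R M (p (o + (s ∸ o))) (p (o + (s′ ∸ o)))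
    detour′ = subst₂ (λ x y → Walk R M (p x) (p y)) (sym (m+[n∸m]≡n o≤s)) (sym (m+[n∸m]≡n o≤s′)) detour

  module _ (h : Fin n → ℕ) (h-step : ∀ {u v} → R u v → h v ≤ suc (h u)) where

    potential-bound : ∀ {ℓ u v} → Walk R ℓ u v → h v ≤ ℓ + h u
    potential-bound [] = ≤-refl
    potential-bound {suc ℓ} {u} (_∷_ {v = v} e p) = ≤-trans (potential-bound p)
      (subst (ℓ + h v ≤_) (+-suc ℓ (h u)) (+-monoʳ-≤ ℓ (h-step e)))

    shortest-by-potential : ∀ {ℓ p} → IsWalk R ℓ p → h (p ℓ) ≡ ℓ + h (p 0) → IsShortestPath R ℓ p
    shortest-by-potential {ℓ} {p} w rise = w , minimal
      where
      minimal : ∀ M q → IsWalk R M q → q 0 ≡ p 0 → q M ≡ p ℓ → ℓ ≤ M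
      minimal M q wq q0≡p0 qM≡pℓ = +-cancelʳ-≤ (h (p 0)) ℓ M (begin
        ℓ + h (p 0) ≡⟨ sym rise ⟩
        h (p ℓ)     ≡⟨ cong h (sym qM≡pℓ) ⟩
        h (q M)     ≤⟨ potential-bound (isWalk⇒walk wq 0 M ≤-refl) ⟩
        M + h (q 0) ≡⟨ cong (λ x → M + h x) q0≡p0 ⟩
        M + h (p 0) ∎)
        where open ≤-Reasoning

module _ {n : ℕ} (Arc : Fin n → Fin n → Set) (Arc? : Decidable Arc) (arc-irrefl : ∀ u → ¬ Arc u u) where

  private
    adjacent : Fin n → Fin n → Bool
    adjacent u v = isYes (Arc? u v) ∨ isYes (Arc? v u)

    adjacent⇔ : ∀ {u v} → T (adjacent u v) ⇔ (Arc u v ⊎ Arc v u)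
    adjacent⇔ {u} {v} = mk⇔
      (Sum.map (toWitness {a? = Arc? u v}) (toWitness {a? = Arc? v u}) ∘′ Equivalence.to T-∨)
      (Equivalence.from T-∨ ∘′ Sum.map (fromWitness {a? = Arc? u v}) (fromWitness {a? = Arc? v u}))

  fromArcs : Graph n
  fromArcs = record
    { adj    = adjacent
    ; sym    = λ u v → ∨-comm (isYes (Arc? u v)) (isYes (Arc? v u))
    ; irrefl = λ u e → [ arc-irrefl u , arc-irrefl u ] (Equivalence.to adjacent⇔ e)
    }

  edge-fromArcs⁺ : ∀ {u v} → Arc u v → Edge fromArcs u v
  edge-fromArcs⁺ arc = Equivalence.from adjacent⇔ (inj₁ arc)

  edge-fromArcs⁻ : ∀ {u v} → Edge fromArcs u v → Arc u v ⊎ Arc v u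
  edge-fromArcs⁻ = Equivalence.to adjacent⇔

module _ {n : ℕ} {G : Graph n} where

  edge-sym : ∀ {u v} → Edge G u v → Edge G v u
  edge-sym {u} {v} = subst T (Graph.sym G u v)

  edgeMinus-sym : ∀ {F u v} → EdgeMinus G F u v → EdgeMinus G F v u
  edgeMinus-sym (e , uv∉F , vu∉F) = edge-sym e , vu∉F , uv∉F

  edgeMinus-byLabel : ∀ {F u v} (κ : Fin n × Fin n → ℕ) → κ (v , u) ≡ κ (u , v) →
                      κ (u , v) ∉ map κ F → Edge G u v → EdgeMinus G F u v
  edgeMinus-byLabel {F} κ κ-sym κuv∉ e =
    e , (λ uv∈F → κuv∉ (∈-map⁺ κ uv∈F)) , (λ vu∈F → κuv∉ (subst (_∈ map κ F) κ-sym (∈-map⁺ κ vu∈F)))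

pigeonhole-∉ : ∀ K (xs : List ℕ) → length xs < K → ∃[ c ] c < K × c ∉ xs
pigeonhole-∉ (suc K) xs |xs|≤K with any? (K ≟_) xs
... | no K∉xs = K , ≤-refl , K∉xs
... | yes K∈xs =
  let c , c<K , c∉ys = pigeonhole-∉ K ys (<-≤-trans ys-shorter (≤-pred |xs|≤K))
  in c , m≤n⇒m≤1+n c<K , λ c∈xs → c∉ys (∈-filter⁺ (λ x → ¬? (x ≟ K)) c∈xs (<⇒≢ c<K))
  where
  ys : List ℕ
  ys = filter (λ x → ¬? (x ≟ K)) xs
  ys-shorter : length ys < length xs
  ys-shorter = filter-notAll (λ x → ¬? (x ≟ K)) xs (Any.map (λ K≡x x≢K → x≢K (sym K≡x)) K∈xs)

pigeonhole-∉₂ : ∀ K (xs : List ℕ) → suc (length xs) < K →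
                ∃[ lo ] ∃[ hi ] lo < hi × hi < K × lo ∉ xs × hi ∉ xs
pigeonhole-∉₂ K xs 1+|xs|<K with pigeonhole-∉ K xs (<-trans (n<1+n _) 1+|xs|<K)
... | c₁ , c₁<K , c₁∉ with pigeonhole-∉ K (c₁ ∷ xs) 1+|xs|<K
...   | c₂ , c₂<K , c₂∉ with <-cmp c₁ c₂
...     | tri< c₁<c₂ _ _ = c₁ , c₂ , c₁<c₂ , c₂<K , c₁∉ , c₂∉ ∘ there
...     | tri≈ _ c₁≡c₂ _ = contradiction (here (sym c₁≡c₂)) c₂∉
...     | tri> _ _ c₂<c₁ = c₂ , c₁ , c₂<c₁ , c₁<K , c₂∉ ∘ there , c₁∉

length-cartesianProductWith : ∀ {A B C : Set} (f : A → B → C) xs ys →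
                              length (cartesianProductWith f xs ys) ≡ length xs * length ys
length-cartesianProductWith f []       ys = refl
length-cartesianProductWith f (x ∷ xs) ys = begin
  length (map (f x) ys ++ cartesianProductWith f xs ys)         ≡⟨ length-++ (map (f x) ys) ⟩
  length (map (f x) ys) + length (cartesianProductWith f xs ys) ≡⟨ cong₂ _+_ (length-map (f x) ys)
                                                                      (length-cartesianProductWith f xs ys) ⟩
  length ys + length xs * length ys                             ∎
  where open ≡-Reasoning

2*[1+n]∸1≡1+2*n : ∀ n → 2 * suc n ∸ 1 ≡ suc (2 * n)
2*[1+n]∸1≡1+2*n n = cong (_∸ 1) (*-suc 2 n)

replacementPath-budget≥0 : ∀ {n} {G : Graph n} {r ℓ p} → IsReplacementPath G r ℓ p → + 0 ℤ.≤ r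
replacementPath-budget≥0 (_ , |F|≤r , _) = ℤ.≤-trans (+≤+ z≤n) |F|≤r

K₁ : Graph 1
K₁ = record { adj = λ _ _ → false ; sym = λ _ _ → refl ; irrefl = λ _ () }

trivialPath-K₁ : ∀ f → IsReplacementPath K₁ (+ f) 0 (λ _ → Fin.zero)
trivialPath-K₁ f = [] , +≤+ z≤n , [] , (λ _ ()) , (λ _ _ _ _ _ → z≤n)

negative-budget-unrestorable : ∀ {f q r} → 0 < q → r ℤ.< + 0 → ¬ Restorable f q r
negative-budget-unrestorable {f} 0<q r<0 restorable =
  let _ , _ , _ , _ , pieces = restorable 1 K₁ 0 (λ _ → Fin.zero) (trivialPath-K₁ f)
  in ℤ.<-irrefl refl (ℤ.≤-<-trans (replacementPath-budget≥0 {G = K₁} (pieces 0 0<q)) r<0)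

clamp : ∀ B → ℕ → Fin (suc B)
clamp B t = fromℕ< (s≤s (m⊓n≤n t B))

toℕ-clamp : ∀ {B t} → t ≤ B → toℕ (clamp B t) ≡ t
toℕ-clamp t≤B = trans (toℕ-fromℕ< _) (m≤n⇒m⊓n≡m t≤B)

clamp-toℕ : ∀ {B} (i : Fin (suc B)) → clamp B (toℕ i) ≡ i
clamp-toℕ i = toℕ-injective (toℕ-clamp (toℕ≤pred[n] i))

module HardInstance (k₀ m₀ : ℕ) where

  k m h a L : ℕ
  k = suc k₀
  m = suc (suc m₀)
  h = suc m₀
  a = suc (3 * m)
  L = a + 3 * h

  -- Opaque so that unification does not unfold the vertex type Fin (suc h * suc N).
  opaque
    N : ℕ
    N = k * L

    N-def : N ≡ k * L
    N-def = refl

  V : Set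
  V = Fin (suc h * suc N)

  -- vtx l t is position t of layer l, layer 0 being the spine; out-of-range coordinates are clamped.
  opaque
    vtx : ℕ → ℕ → V
    vtx l t = combine (clamp h l) (clamp N t)

    layer position : V → ℕ
    layer v = toℕ (proj₁ (remQuot {suc h} (suc N) v))
    position v = toℕ (proj₂ (remQuot {suc h} (suc N) v))

    layer-vtx : ∀ {l} t → l ≤ h → layer (vtx l t) ≡ l
    layer-vtx {l} t l≤h =
      trans (cong (λ x → toℕ (proj₁ x)) (remQuot-combine {suc h} {suc N} (clamp h l) (clamp N t))) (toℕ-clamp l≤h)

    position-vtx : ∀ l {t} → t ≤ N → position (vtx l t) ≡ t
    position-vtx l {t} t≤N =
      trans (cong (λ x → toℕ (proj₂ x)) (remQuot-combine {suc h} {suc N} (clamp h l) (clamp N t))) (toℕ-clamp t≤N)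

    vtx-η : ∀ v → vtx (layer v) (position v) ≡ v
    vtx-η v = trans (cong₂ (combine {suc h} {suc N}) (clamp-toℕ (proj₁ lp)) (clamp-toℕ (proj₂ lp)))
                    (combine-remQuot {suc h} (suc N) v)
      where
      lp : Fin (suc h) × Fin (suc N)
      lp = remQuot {suc h} (suc N) v

  spine : ℕ → V
  spine = vtx 0

  jump : ℕ → ℕ → ℕ × ℕ
  jump g c = g * L , g * L + a + 3 * c

  jumps : List (ℕ × ℕ)
  jumps = cartesianProductWith jump (upTo k) (upTo m)

  ∈-jumps⁺ : ∀ {g c} → g < k → c < m → jump g c ∈ jumps
  ∈-jumps⁺ g<k c<m = ∈-cartesianProductWith⁺ jump (∈-upTo⁺ g<k) (∈-upTo⁺ c<m)

  ∈-jumps⁻ : ∀ {t} → t ∈ jumps → ∃[ g ] ∃[ c ] g < k × c < m × t ≡ jump g c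
  ∈-jumps⁻ t∈ with g , c , g∈ , c∈ , refl ← ∈-cartesianProductWith⁻ jump (upTo k) (upTo m) t∈ =
    g , c , ∈-upTo⁻ g∈ , ∈-upTo⁻ c∈ , refl

  jump-within-block : ∀ g {c} → c < m → g * L + a + 3 * c ≤ suc g * L
  jump-within-block g {c} c<m = begin
    g * L + a + 3 * c    ≤⟨ +-monoʳ-≤ (g * L + a) (*-monoʳ-≤ 3 (≤-pred c<m)) ⟩
    g * L + a + 3 * h    ≡⟨ +-assoc (g * L) a (3 * h) ⟩
    g * L + L            ≡⟨ +-comm (g * L) L ⟩
    suc g * L            ∎
    where open ≤-Reasoning

  jump-bounded : ∀ {g c} → g < k → c < m → g * L + a + 3 * c ≤ N
  jump-bounded {g} g<k c<m =
    ≤-trans (jump-within-block g c<m) (≤-trans (*-monoˡ-≤ L g<k) (≤-reflexive (sym N-def)))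

  jump-span : ∀ {t₁ t₂} → (t₁ , t₂) ∈ jumps → 2 + t₁ ≤ t₂ × t₂ ≤ N
  jump-span t∈ with g , c , g<k , c<m , refl ← ∈-jumps⁻ t∈ =
    ≤-trans (subst (_≤ g * L + a) (+-comm (g * L) 2) (+-monoʳ-≤ (g * L) (s≤s (s≤s z≤n))))
            (m≤m+n (g * L + a) (3 * c)) ,
    jump-bounded g<k c<m

  Arc : ℕ × ℕ → ℕ × ℕ → Set
  Arc (l₁ , t₁) (l₂ , t₂) = (l₁ ≡ l₂ × t₂ ≡ suc t₁)
                          ⊎ (l₁ ≡ 0 × 0 < l₂ × t₁ ≡ t₂)
                          ⊎ (l₁ ≡ 0 × l₂ ≡ 0 × (t₁ , t₂) ∈ jumps)

  arc? : ∀ x y → Dec (Arc x y)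
  arc? (l₁ , t₁) (l₂ , t₂) = (l₁ ≟ l₂ ×-dec t₂ ≟ suc t₁)
                           ⊎-dec (l₁ ≟ 0 ×-dec 0 <? l₂ ×-dec t₁ ≟ t₂)
                           ⊎-dec (l₁ ≟ 0 ×-dec l₂ ≟ 0 ×-dec (t₁ , t₂) ∈? jumps)

  arc-irrefl : ∀ x → ¬ Arc x x
  arc-irrefl (l , t) (inj₁ (_ , t≡1+t))                = 1+n≢n (sym t≡1+t)
  arc-irrefl (l , t) (inj₂ (inj₁ (l≡0 , 0<l , _)))     = <⇒≢ 0<l (sym l≡0)
  arc-irrefl (l , t) (inj₂ (inj₂ (_ , _ , tt∈jumps))) = 1+n≰n (≤-trans (n≤1+n _) (proj₁ (jump-span tt∈jumps)))

  coords : V → ℕ × ℕ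
  coords v = layer v , position v

  coords-vtx : ∀ {l t} → l ≤ h → t ≤ N → coords (vtx l t) ≡ (l , t)
  coords-vtx {l} {t} l≤h t≤N = cong₂ _,_ (layer-vtx t l≤h) (position-vtx l t≤N)

  VArc : V → V → Set
  VArc u v = Arc (coords u) (coords v)

  VArc? : ∀ u v → Dec (VArc u v)
  VArc? u v = arc? (coords u) (coords v)

  VArc-irrefl : ∀ u → ¬ VArc u u
  VArc-irrefl u = arc-irrefl (coords u)

  G : Graph (suc h * suc N)
  G = fromArcs VArc VArc? VArc-irrefl

  arc⇒edge : ∀ {l₁ t₁ l₂ t₂} → l₁ ≤ h → t₁ ≤ N → l₂ ≤ h → t₂ ≤ N →
             Arc (l₁ , t₁) (l₂ , t₂) → Edge G (vtx l₁ t₁) (vtx l₂ t₂)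
  arc⇒edge l₁≤h t₁≤N l₂≤h t₂≤N arc =
    edge-fromArcs⁺ VArc VArc? VArc-irrefl (subst₂ Arc (sym (coords-vtx l₁≤h t₁≤N)) (sym (coords-vtx l₂≤h t₂≤N)) arc)

  layer-edge : ∀ {l t} → l ≤ h → suc t ≤ N → Edge G (vtx l t) (vtx l (suc t))
  layer-edge l≤h t<N = arc⇒edge l≤h (<⇒≤ t<N) l≤h t<N (inj₁ (refl , refl))

  rung-edge : ∀ {l t} → 0 < l → l ≤ h → t ≤ N → Edge G (spine t) (vtx l t)
  rung-edge 0<l l≤h t≤N = arc⇒edge z≤n t≤N l≤h t≤N (inj₂ (inj₁ (refl , 0<l , refl)))

  jump-edge : ∀ {t₁ t₂} → (t₁ , t₂) ∈ jumps → Edge G (spine t₁) (spine t₂)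
  jump-edge t∈ = let 2+t₁≤t₂ , t₂≤N = jump-span t∈ in
    arc⇒edge z≤n (≤-trans (m≤n+m _ 2) (≤-trans 2+t₁≤t₂ t₂≤N)) z≤n t₂≤N (inj₂ (inj₂ (refl , refl , t∈)))

  spineArc : ℕ × ℕ → V × V
  spineArc (t₁ , t₂) = spine t₁ , spine t₂

  jumpFaults : Faults (suc h * suc N)
  jumpFaults = map spineArc jumps

  jumpFaults-span : ∀ {u v} → (u , v) ∈ jumpFaults → 2 + position u ≤ position v
  jumpFaults-span uv∈ with (t₁ , t₂) , t∈ , refl ← ∈-map⁻ spineArc uv∈ =
    let 2+t₁≤t₂ , t₂≤N = jump-span t∈ in
    subst₂ (λ x y → 2 + x ≤ y) (sym (position-vtx 0 (≤-trans (m≤n+m _ 2) (≤-trans 2+t₁≤t₂ t₂≤N))))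
           (sym (position-vtx 0 t₂≤N)) 2+t₁≤t₂

  jumpArc⇒fault : ∀ {u v} → layer u ≡ 0 → layer v ≡ 0 → (position u , position v) ∈ jumps →
                  (u , v) ∈ jumpFaults
  jumpArc⇒fault {u} {v} lu≡0 lv≡0 t∈ =
    subst (_∈ jumpFaults) (cong₂ _,_ (onSpine lu≡0) (onSpine lv≡0)) (∈-map⁺ spineArc t∈)
    where
    onSpine : ∀ {w} → layer w ≡ 0 → spine (position w) ≡ w
    onSpine {w} lw≡0 = trans (cong (λ l → vtx l (position w)) (sym lw≡0)) (vtx-η w)

  position-step : ∀ {u v} → EdgeMinus G jumpFaults u v → position v ≤ suc (position u)
  position-step (e , uv∉ , vu∉) with edge-fromArcs⁻ VArc VArc? VArc-irrefl e
  ... | inj₁ (inj₁ (_ , t₂≡1+t₁))              = ≤-reflexive t₂≡1+t₁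
  ... | inj₁ (inj₂ (inj₁ (_ , _ , t₁≡t₂)))     = m≤n⇒m≤1+n (≤-reflexive (sym t₁≡t₂))
  ... | inj₁ (inj₂ (inj₂ (l₁≡0 , l₂≡0 , t∈)))  = contradiction (jumpArc⇒fault l₁≡0 l₂≡0 t∈) uv∉
  ... | inj₂ (inj₁ (_ , t₁≡1+t₂))              = m≤n⇒m≤1+n (≤-trans (n≤1+n _) (≤-reflexive (sym t₁≡1+t₂)))
  ... | inj₂ (inj₂ (inj₁ (_ , _ , t₂≡t₁)))     = m≤n⇒m≤1+n (≤-reflexive t₂≡t₁)
  ... | inj₂ (inj₂ (inj₂ (l₂≡0 , l₁≡0 , t∈)))  = contradiction (jumpArc⇒fault l₂≡0 l₁≡0 t∈) vu∉

  spine-replacementPath : ∀ f → k * m ≤ f → IsReplacementPath G (+ f) N spine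
  spine-replacementPath f km≤f =
    jumpFaults , +≤+ |jumpFaults|≤f , All.tabulate faults-are-edges ,
    shortest-by-potential position position-step spine-walk rise
    where
    |jumpFaults|≤f : length jumpFaults ≤ f
    |jumpFaults|≤f = subst (_≤ f) (sym (begin
      length jumpFaults         ≡⟨ length-map spineArc jumps ⟩
      length jumps              ≡⟨ length-cartesianProductWith jump (upTo k) (upTo m) ⟩
      length (upTo k) * length (upTo m) ≡⟨ cong₂ _*_ (length-upTo k) (length-upTo m) ⟩
      k * m                     ∎)) km≤f
      where open ≡-Reasoning
    faults-are-edges : ∀ {e} → e ∈ jumpFaults → Edge G (proj₁ e) (proj₂ e)
    faults-are-edges e∈ with _ , t∈ , refl ← ∈-map⁻ spineArc e∈ = jump-edge t∈
    spine-walk : IsWalk (EdgeMinus G jumpFaults) N spine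
    spine-walk i i<N =
      layer-edge z≤n i<N ,
      (λ fault → 1+n≰n (span fault (<⇒≤ i<N) i<N)) ,
      (λ fault → 1+n≰n (≤-trans (≤-trans (n≤1+n (suc i)) (n≤1+n _)) (span fault i<N (<⇒≤ i<N))))
      where
      span : ∀ {s s′} → (spine s , spine s′) ∈ jumpFaults → s ≤ N → s′ ≤ N → 2 + s ≤ s′
      span fault s≤N s′≤N =
        subst₂ (λ x y → 2 + x ≤ y) (position-vtx 0 s≤N) (position-vtx 0 s′≤N) (jumpFaults-span fault)
    rise : position (spine N) ≡ N + position (spine 0)
    rise = trans (position-vtx 0 ≤-refl) (sym (trans (cong (λ x → N + x) (position-vtx 0 z≤n)) (+-identityʳ N)))

  -- jumpLabel (g * L) sends the jump to gL + a + 3c to c; layerLabel sends the rungs to layer d + 1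
  -- and the edges inside it to d. A fault with a given label can only block edges with that label.
  jumpLabel : ℕ → V × V → ℕ
  jumpLabel o (u , v) = (position u ⊔ position v ∸ (o + a)) / 3

  layerLabel : V × V → ℕ
  layerLabel (u , v) = layer u ⊔ layer v ∸ 1

  jumpLabel-sym : ∀ o u v → jumpLabel o (v , u) ≡ jumpLabel o (u , v)
  jumpLabel-sym o u v = cong (λ x → (x ∸ (o + a)) / 3) (⊔-comm (position v) (position u))

  layerLabel-sym : ∀ u v → layerLabel (v , u) ≡ layerLabel (u , v)
  layerLabel-sym u v = cong (_∸ 1) (⊔-comm (layer v) (layer u))

  jumpLabel-jump : ∀ {g c} → g < k → c < m → jumpLabel (g * L) (spineArc (jump g c)) ≡ c
  jumpLabel-jump {g} {c} g<k c<m = begin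
    (position (spine o) ⊔ position (spine (o + a + 3 * c)) ∸ (o + a)) / 3
      ≡⟨ cong (λ x → (x ∸ (o + a)) / 3) (cong₂ _⊔_ (position-vtx 0 o≤N) (position-vtx 0 (jump-bounded g<k c<m))) ⟩
    (o ⊔ (o + a + 3 * c) ∸ (o + a)) / 3
      ≡⟨ cong (λ x → (x ∸ (o + a)) / 3) (m≤n⇒m⊔n≡n (≤-trans (m≤m+n o a) (m≤m+n (o + a) (3 * c)))) ⟩
    (o + a + 3 * c ∸ (o + a)) / 3 ≡⟨ cong (_/ 3) (m+n∸m≡n (o + a) (3 * c)) ⟩
    3 * c / 3                     ≡⟨ cong (_/ 3) (*-comm 3 c) ⟩
    c * 3 / 3                     ≡⟨ m*n/n≡m c 3 ⟩
    c                             ∎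
    where
    open ≡-Reasoning
    o : ℕ
    o = g * L
    o≤N : o ≤ N
    o≤N = ≤-trans (≤-trans (m≤m+n o a) (m≤m+n (o + a) (3 * c))) (jump-bounded g<k c<m)

  ShortcutWithin : Faults (suc h * suc N) → ℕ → ℕ → Set
  ShortcutWithin F x y = ∃[ s ] ∃[ s′ ] ∃[ M ]
    x ≤ s × s′ ≤ y × s + M < s′ × Walk (EdgeMinus G F) M (spine s) (spine s′)

  Blocked : ℕ → ℕ → Set
  Blocked x y = ∀ F → length F ≤ m₀ → ShortcutWithin F x y

  module _ (F : Faults (suc h * suc N)) where

    free-jump : ∀ {g c} → g < k → c < m → c ∉ map (jumpLabel (g * L)) F →
                EdgeMinus G F (spine (g * L)) (spine (g * L + a + 3 * c))
    free-jump {g} {c} g<k c<m c∉ =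
      edgeMinus-byLabel {G = G} (jumpLabel (g * L)) (jumpLabel-sym (g * L) _ _)
        (subst (_∉ map (jumpLabel (g * L)) F) (sym (jumpLabel-jump g<k c<m)) c∉) (jump-edge (∈-jumps⁺ g<k c<m))

    free-rung : ∀ {d t} → d < h → t ≤ N → d ∉ map layerLabel F → EdgeMinus G F (spine t) (vtx (suc d) t)
    free-rung {d} {t} d<h t≤N d∉ =
      edgeMinus-byLabel {G = G} layerLabel (layerLabel-sym _ _)
        (subst (_∉ map layerLabel F) (sym (cong₂ (λ x y → x ⊔ y ∸ 1) (layer-vtx t z≤n) (layer-vtx t d<h))) d∉)
        (rung-edge (s≤s z≤n) d<h t≤N)

    free-layer-edge : ∀ {d t} → d < h → suc t ≤ N → d ∉ map layerLabel F →
                      EdgeMinus G F (vtx (suc d) t) (vtx (suc d) (suc t))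
    free-layer-edge {d} {t} d<h t<N d∉ =
      edgeMinus-byLabel {G = G} layerLabel (layerLabel-sym _ _)
        (subst (_∉ map layerLabel F) (sym label) d∉) (layer-edge d<h t<N)
      where
      label : layerLabel (vtx (suc d) t , vtx (suc d) (suc t)) ≡ d
      label = trans (cong₂ (λ x y → x ⊔ y ∸ 1) (layer-vtx t d<h) (layer-vtx (suc t) d<h)) (⊔-idem d)

    layer-descent : ∀ {d} s j → d < h → s + j ≤ N → d ∉ map layerLabel F →
                    Walk (EdgeMinus G F) j (vtx (suc d) (s + j)) (vtx (suc d) s)
    layer-descent s zero d<h _ d∉ rewrite +-identityʳ s = []
    layer-descent {d} s (suc j) d<h s+j<N d∉ =
      subst (λ x → EdgeMinus G F (vtx (suc d) x) (vtx (suc d) (s + j))) (sym (+-suc s j))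
        (edgeMinus-sym {G = G} (free-layer-edge d<h s+j<N′ d∉)) ∷
      layer-descent s j d<h (<⇒≤ s+j<N′) d∉
      where
      s+j<N′ : suc (s + j) ≤ N
      s+j<N′ = subst (_≤ N) (+-suc s j) s+j<N

    labels-short : ∀ (κ : V × V → ℕ) → length F ≤ m₀ → length (map κ F) < h
    labels-short κ |F|≤m₀ = subst (_< h) (sym (length-map κ F)) (s≤s |F|≤m₀)

    jump-pair-shortcut : ∀ {g lo hi} → g < k → lo < hi → hi < m →
                         lo ∉ map (jumpLabel (g * L)) F → hi ∉ map (jumpLabel (g * L)) F →
                         ShortcutWithin F (g * L + 3 * m) (suc g * L)
    jump-pair-shortcut {g} {lo} {hi} g<k lo<hi hi<m lo∉ hi∉ =
      o + a + 3 * lo , o + a + 3 * hi , 2 ,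
      ≤-trans (+-monoʳ-≤ o (n≤1+n (3 * m))) (m≤m+n (o + a) (3 * lo)) ,
      jump-within-block g hi<m ,
      subst (_< o + a + 3 * hi) (sym (+-assoc (o + a) (3 * lo) 2))
        (+-monoʳ-< (o + a) (subst (_≤ 3 * hi) (3*[1+n]≡1+[3*n+2] lo) (*-monoʳ-≤ 3 lo<hi))) ,
      edgeMinus-sym {G = G} (free-jump g<k (<-trans lo<hi hi<m) lo∉) ∷ free-jump g<k hi<m hi∉ ∷ []
      where
      o : ℕ
      o = g * L
      3*[1+n]≡1+[3*n+2] : ∀ n → 3 * suc n ≡ suc (3 * n + 2)
      3*[1+n]≡1+[3*n+2] = solve-∀

  jumpWindow-blocked : ∀ {g} → g < k → Blocked (g * L) (g * L + a)
  jumpWindow-blocked {g} g<k F |F|≤m₀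
    with c , c<m , c∉ ← pigeonhole-∉ m (map (jumpLabel (g * L)) F) (<-trans (labels-short F _ |F|≤m₀) (n<1+n h))
       | d , d<h , d∉ ← pigeonhole-∉ h (map layerLabel F) (labels-short F _ |F|≤m₀) =
    o , o + a , _ , ≤-refl , ≤-refl , +-monoʳ-< o (s≤s detour-short) ,
    free-jump F g<k c<m c∉ ∷ free-rung F d<h landing≤N d∉ ∷
      (layer-descent F (o + a) (3 * c) d<h landing≤N d∉ ++ʷ
       edgeMinus-sym {G = G} (free-rung F d<h (≤-trans (m≤m+n (o + a) (3 * c)) landing≤N) d∉) ∷ [])
    where
    o : ℕ
    o = g * L
    landing≤N : o + a + 3 * c ≤ N
    landing≤N = jump-bounded g<k c<m
    detour-short : suc (suc (3 * c + 1)) ≤ 3 * m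
    detour-short = subst (_≤ 3 * m) (3*[1+n]≡2+[3*n+1] c) (*-monoʳ-≤ 3 c<m)
      where
      3*[1+n]≡2+[3*n+1] : ∀ n → 3 * suc n ≡ suc (suc (3 * n + 1))
      3*[1+n]≡2+[3*n+1] = solve-∀

  landingWindow-blocked : ∀ {g} → g < k → Blocked (g * L + 3 * m) (suc g * L)
  landingWindow-blocked {g} g<k F |F|≤m₀ =
    let lo , hi , lo<hi , hi<m , lo∉ , hi∉ =
          pigeonhole-∉₂ m (map (jumpLabel (g * L)) F) (s≤s (labels-short F _ |F|≤m₀))
    in jump-pair-shortcut F g<k lo<hi hi<m lo∉ hi∉

  piece-ends-before : ∀ {x′ y′ x y} → x′ ≤ y′ →
                      IsReplacementPath G (+ m₀) (y′ ∸ x′) (subpathVertices spine x′) →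
                      x′ ≤ x → Blocked x y → y′ < y
  piece-ends-before {x′} {y′} x′≤y′ (F , +≤+ |F|≤m₀ , _ , sp) x′≤x blocked = ≰⇒> λ y≤y′ →
    let s , s′ , M , x≤s , s′≤y , s+M<s′ , detour = blocked F |F|≤m₀
    in <⇒≱ s+M<s′ (shortest-between {p = spine} sp (≤-trans x′≤x x≤s) (≤-trans (m≤m+n s M) (<⇒≤ s+M<s′))
                     (≤-trans s′≤y (≤-trans y≤y′ (≤-reflexive (sym (m+[n∸m]≡n x′≤y′))))) detour)

  module _ {b : ℕ → ℕ} (b₀ : b 0 ≡ 0) (ordered : ∀ i → i < 2 * k ∸ 1 → b i ≤ b (suc i))
           (pieces : ∀ i → i < 2 * k ∸ 1 →
                     IsReplacementPath G (+ m₀) (b (suc i) ∸ b i) (subpathVertices spine (b i))) where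

    boundary-before-window : ∀ {i x y} → i ≤ 2 * k₀ → b i ≤ x → Blocked x y → b (suc i) < y
    boundary-before-window {i} i≤2k₀ = piece-ends-before (ordered i i<q) (pieces i i<q)
      where
      i<q : i < 2 * k ∸ 1
      i<q = subst (i <_) (sym (2*[1+n]∸1≡1+2*n k₀)) (s≤s i≤2k₀)

    even-boundary-behind : ∀ g → g < k → b (2 * g) ≤ g * L
    even-boundary-behind zero    _     = ≤-reflexive b₀
    even-boundary-behind (suc g) g+1<k = subst (λ i → b i ≤ suc g * L) (sym (*-suc 2 g))
      (<⇒≤ (boundary-before-window odd≤ (≤-pred first) (landingWindow-blocked g<k)))
      where
      g<k : g < k
      g<k = <-trans (n<1+n g) g+1<k
      odd≤ : suc (2 * g) ≤ 2 * k₀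
      odd≤ = ≤-trans (n≤1+n _) (subst (_≤ 2 * k₀) (*-suc 2 g) (*-monoʳ-≤ 2 (≤-pred g+1<k)))
      first : b (suc (2 * g)) < suc (g * L + 3 * m)
      first = subst (b (suc (2 * g)) <_) (+-suc (g * L) (3 * m))
        (boundary-before-window (*-monoʳ-≤ 2 (≤-pred g<k)) (even-boundary-behind g g<k) (jumpWindow-blocked g<k))

  unrestorable : ∀ f → k * m ≤ f → ¬ Restorable f (2 * k ∸ 1) (+ m₀)
  unrestorable f km≤f restorable
    with b , b₀ , b-last , ordered , pieces ← restorable _ G N spine (spine-replacementPath f km≤f) =
    1+n≰n (≤-trans last-piece (subst (k₀ * L + a ≤_) (sym b-end) last-block≤N))
    where
    last-piece : b (suc (2 * k₀)) < k₀ * L + a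
    last-piece = boundary-before-window b₀ ordered pieces ≤-refl (even-boundary-behind b₀ ordered pieces k₀ ≤-refl)
                   (jumpWindow-blocked ≤-refl)
    b-end : b (suc (2 * k₀)) ≡ N
    b-end = trans (cong b (sym (2*[1+n]∸1≡1+2*n k₀))) b-last
    last-block≤N : k₀ * L + a ≤ N
    last-block≤N = ≤-trans (m≤m+n (k₀ * L + a) 0) (jump-bounded {k₀} {0} ≤-refl (s≤s z≤n))

corollary3p4 : (k f : ℕ) → .{{_ : NonZero k}} → 1 ≤ k → 1 ≤ f →
    ¬ Restorable f (2 * k ∸ 1) (+ (f / k) - + 2)
corollary3p4 (suc k₀) f _ _ with f / suc k₀ in f/k≡
... | 0 = negative-budget-unrestorable (subst (0 <_) (sym (2*[1+n]∸1≡1+2*n k₀)) (s≤s z≤n)) -<+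
... | 1 = negative-budget-unrestorable (subst (0 <_) (sym (2*[1+n]∸1≡1+2*n k₀)) (s≤s z≤n)) -<+
... | suc (suc m₀) = HardInstance.unrestorable k₀ m₀ f k*m≤f
  where
  k*m≤f : suc k₀ * suc (suc m₀) ≤ f
  k*m≤f = subst (_≤ f) (trans (cong (_* suc k₀) f/k≡) (*-comm (suc (suc m₀)) (suc k₀))) (m/n*n≤m f (suc k₀))
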